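{- Let $m,n,t$ be positive integers with $m<\dfrac t2$ and $n>t-m+1$. Then $dyn_t(K_m\Box K_n)=m(t-m+1)$.
   Context: $K_n$ is the complete graph on $n$ vertices; $G\Box H$ is the Cartesian product (vertex set $V(G)\times V(H)$, $(u,v)\sim(u',v')$ iff $u=u'$ and $vv'\in E(H)$, or $v=v'$ and $uu'\in E(G)$). For constant threshold $t$, a set $D$ of vertices is a $t$-dynamic monopoly if starting from $D$ and repeatedly adding any vertex having at least $t$ neighbors in the current set eventually yields all vertices; $dyn_t$ is the minimum size of a $t$-dynamic monopoly. -}

module Defs where

open import Data.Nat using (ℕ; _≤_)
open import Data.Bool using (Bool; not; _∧_; _∨_)
open import Data.Fin using (Fin; remQuot)
open import Data.Fin.Properties using (_≟_)
open import Data.Fin.Subset using (Subset; ⊤; ⁅_⁆; _∩_; _∪_; ∣_∣)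
open import Data.Vec using (tabulate)
open import Data.Product using (_×_; ∃; _,_)
open import Relation.Binary.PropositionalEquality using (_≡_)
open import Relation.Nullary.Decidable using (⌊_⌋)

record Graph : Set where
  field
    order : ℕ
    adj   : Fin order → Fin order → Bool
open Graph public

K : ℕ → Graph
K n = record { order = n ; adj = λ i j → not ⌊ i ≟ j ⌋ }

_□_ : Graph → Graph → Graph
G □ H = record
  { order = order G Data.Nat.* order H
  ; adj   = λ x y → go (remQuot (order H) x) (remQuot (order H) y)
  }
  where
  go : Fin (order G) × Fin (order H) → Fin (order G) × Fin (order H) → Bool
  go (u , v) (u' , v') =
    (⌊ u ≟ u' ⌋ ∧ adj H v v') ∨ (⌊ v ≟ v' ⌋ ∧ adj G u u')

N[_] : (G : Graph) → Fin (order G) → Subset (order G)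
N[ G ] v = tabulate (adj G v)

data Reach (G : Graph) (t : ℕ) (D : Subset (order G)) : Subset (order G) → Set where
  start : Reach G t D D
  add   : ∀ {S} (v : Fin (order G)) → Reach G t D S →
          t ≤ ∣ S ∩ N[ G ] v ∣ → Reach G t D (S ∪ ⁅ v ⁆)

DynMono : (G : Graph) → ℕ → Subset (order G) → Set
DynMono G t D = Reach G t D ⊤

DynEq : Graph → ℕ → ℕ → Set
DynEq G t k =
  (∃ λ D → DynMono G t D × ∣ D ∣ ≡ k) ×
  (∀ D → DynMono G t D → k ≤ ∣ D ∣)

-- Write k = t ∸ m + 1, so t = k + (m ∸ 1), and view K m □ K n as an m × n grid whose rows are
-- copies of K n and whose columns are copies of K m.
--
-- Lower bound: a vertex has only m ∸ 1 neighbours in its column, so the first vertex outside D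
-- activated in a row needs k active neighbours in its row, and these all lie in D. Hence every
-- row meets D in at least k vertices, or lies entirely inside D (and n ≥ k).
--
-- Upper bound: with L = n ∸ k, let D consist of the cells (u, v) with v < u or L + u ≤ v, which is
-- k cells per row since u < m ≤ k. Activate the grid row by row, row i from column i to column
-- L + i ∸ 1. When (i, a) is reached, its active row neighbours are the a cells to its left and the
-- k ∸ i cells of D to its right, and its active column neighbours are the i cells above and the
-- m ∸ 1 ∸ a cells of D below: at least k + (m ∸ 1) = t in total.

module Submission where

open import Defs
open import Data.Nat using (ℕ; zero; suc; _+_; _*_; _∸_; _≤_; _<_; z≤n; s≤s; _<ᵇ_; _≤ᵇ_)
open import Data.Nat.Solver using (module +-*-Solver)
open import Data.Nat.Properties hiding (_≟_)
open import Data.Bool using (Bool; true; false; _∧_; _∨_; not; T)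
open import Data.Bool.Properties using (T-≡; T-∧; T-∨)
open import Data.Unit using (tt)
open import Data.Empty using (⊥; ⊥-elim)
open import Data.Fin as Fin using (Fin; toℕ; fromℕ<; combine; remQuot; _↑ˡ_; _↑ʳ_)
open import Data.Fin.Properties
  using ( _≟_; toℕ<n; toℕ-injective; toℕ-fromℕ<
        ; remQuot-combine; combine-surjective; combine-injectiveˡ)
open import Data.Fin.Subset using (Subset; _∈_; _∩_; _∪_; ⁅_⁆; ∣_∣)
open import Data.Fin.Subset.Properties
  using (_∈?_; ∈⊤; ⊆⊤; ⊆-antisym; x∈p∪q⁻; x∈p∪q⁺; x∈⁅x⁆; x∈⁅y⁆⇒x≡y)
open import Data.Vec using ([]; _∷_; lookup; tabulate)
open import Data.Vec.Properties
  using (lookup-zipWith; lookup∘tabulate; []=⇒lookup; lookup⇒[]=)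
open import Data.Product using (_×_; _,_; proj₁; proj₂; ∃; ∃₂; uncurry)
open import Data.Sum using (_⊎_; inj₁; inj₂; [_,_]′)
import Data.Sum as Sum
open import Function using (_∘_; id)
open import Function.Bundles using (Equivalence)
open import Relation.Binary.PropositionalEquality
open import Relation.Nullary.Decidable using (⌊_⌋; yes; no; fromWitnessFalse)
open import Algebra.Properties.Semiring.Sum +-*-semiring
  using (sum; sum-syntax; sum-cong-≗; ∑-distrib-+; *-distribˡ-sum)

𝟙 : Bool → ℕ
𝟙 true  = 1
𝟙 false = 0

∑-const : ∀ k c → ∑[ _ < k ] c ≡ k * c
∑-const zero    c = refl
∑-const (suc k) c = cong (c +_) (∑-const k c)

∑-mono-≤ : ∀ {k} {f g : Fin k → ℕ} → (∀ x → f x ≤ g x) → sum f ≤ sum g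
∑-mono-≤ {zero}  f≤g = z≤n
∑-mono-≤ {suc k} f≤g = +-mono-≤ (f≤g Fin.zero) (∑-mono-≤ (f≤g ∘ Fin.suc))

∑-↑ : ∀ a b (h : Fin (a + b) → ℕ) →
      ∑[ x < a + b ] h x ≡ ∑[ i < a ] h (i ↑ˡ b) + ∑[ j < b ] h (a ↑ʳ j)
∑-↑ zero    b h = refl
∑-↑ (suc a) b h = trans (cong (h Fin.zero +_) (∑-↑ a b (h ∘ Fin.suc)))
                        (sym (+-assoc (h Fin.zero) _ _))

∑-combine : ∀ m n (h : Fin (m * n) → ℕ) →
            ∑[ x < m * n ] h x ≡ ∑[ u < m ] ∑[ v < n ] h (combine u v)
∑-combine zero    n h = refl
∑-combine (suc m) n h =
  trans (∑-↑ n (m * n) h) (cong (∑[ v < n ] h (v ↑ˡ m * n) +_) (∑-combine m n _))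

∑-δ : ∀ k (i : Fin k) (f : Fin k → ℕ) → ∑[ u < k ] (𝟙 ⌊ i ≟ u ⌋ * f u) ≡ f i
∑-δ (suc k) Fin.zero f = begin
  f Fin.zero + 0 + ∑[ u < k ] 0 ≡⟨ cong₂ _+_ (+-identityʳ _) (∑-const k 0) ⟩
  f Fin.zero + k * 0            ≡⟨ cong (f Fin.zero +_) (*-zeroʳ k) ⟩
  f Fin.zero + 0                ≡⟨ +-identityʳ _ ⟩
  f Fin.zero                    ∎
  where open ≡-Reasoning
∑-δ (suc k) (Fin.suc i) f = trans (sum-cong-≗ δ-suc) (∑-δ k i (f ∘ Fin.suc))
  where
  δ-suc : ∀ u → 𝟙 ⌊ Fin.suc i ≟ Fin.suc u ⌋ * f (Fin.suc u) ≡ 𝟙 ⌊ i ≟ u ⌋ * f (Fin.suc u)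
  δ-suc u with i ≟ u
  ... | yes _ = refl
  ... | no  _ = refl

∣∣≡∑𝟙 : ∀ {k} (S : Subset k) → ∣ S ∣ ≡ ∑[ x < k ] 𝟙 (lookup S x)
∣∣≡∑𝟙 []          = refl
∣∣≡∑𝟙 (true  ∷ S) = cong suc (∣∣≡∑𝟙 S)
∣∣≡∑𝟙 (false ∷ S) = ∣∣≡∑𝟙 S

𝟙-mono : ∀ {a b} → (T a → T b) → 𝟙 a ≤ 𝟙 b
𝟙-mono {false}         _ = z≤n
𝟙-mono {true}  {true}  _ = ≤-refl
𝟙-mono {true}  {false} f = ⊥-elim (f tt)

∑𝟙-mono : ∀ {k} {p q : Fin k → Bool} → (∀ x → T (p x) → T (q x)) →
          ∑[ x < k ] 𝟙 (p x) ≤ ∑[ x < k ] 𝟙 (q x)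
∑𝟙-mono p⇒q = ∑-mono-≤ (λ x → 𝟙-mono (p⇒q x))

∑𝟙-not+∑𝟙 : ∀ k (p : Fin k → Bool) → ∑[ x < k ] 𝟙 (not (p x)) + ∑[ x < k ] 𝟙 (p x) ≡ k
∑𝟙-not+∑𝟙 k p = begin
  ∑[ x < k ] 𝟙 (not (p x)) + ∑[ x < k ] 𝟙 (p x) ≡⟨ ∑-distrib-+ (𝟙 ∘ not ∘ p) (𝟙 ∘ p) ⟨
  ∑[ x < k ] (𝟙 (not (p x)) + 𝟙 (p x))          ≡⟨ sum-cong-≗ (𝟙-not+𝟙 ∘ p) ⟩
  ∑[ x < k ] 1                                   ≡⟨ ∑-const k 1 ⟩
  k * 1                                          ≡⟨ *-identityʳ k ⟩
  k                                              ∎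
  where
  open ≡-Reasoning
  𝟙-not+𝟙 : ∀ b → 𝟙 (not b) + 𝟙 b ≡ 1
  𝟙-not+𝟙 true  = refl
  𝟙-not+𝟙 false = refl

∑𝟙-≢ : ∀ {k} (i : Fin k) → ∑[ u < k ] 𝟙 (not ⌊ i ≟ u ⌋) ≡ k ∸ 1
∑𝟙-≢ {k} i = begin
  ∑≢                            ≡⟨ m+n∸n≡m ∑≢ 1 ⟨
  ∑≢ + 1 ∸ 1                    ≡⟨ cong (λ z → ∑≢ + z ∸ 1) ∑≡ ⟨
  ∑≢ + ∑[ u < k ] 𝟙 ⌊ i ≟ u ⌋ ∸ 1 ≡⟨ cong (_∸ 1) (∑𝟙-not+∑𝟙 k (λ u → ⌊ i ≟ u ⌋)) ⟩
  k ∸ 1                         ∎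
  where
  open ≡-Reasoning
  ∑≢ = ∑[ u < k ] 𝟙 (not ⌊ i ≟ u ⌋)
  ∑≡ : ∑[ u < k ] 𝟙 ⌊ i ≟ u ⌋ ≡ 1
  ∑≡ = trans (sum-cong-≗ (λ u → sym (*-identityʳ (𝟙 ⌊ i ≟ u ⌋)))) (∑-δ k i (λ _ → 1))

∈⇒T-lookup : ∀ {k} {S : Subset k} {x} → x ∈ S → T (lookup S x)
∈⇒T-lookup x∈S = Equivalence.from T-≡ ([]=⇒lookup x∈S)

T-lookup⇒∈ : ∀ {k} {S : Subset k} {x} → T (lookup S x) → x ∈ S
T-lookup⇒∈ {S = S} {x} p = lookup⇒[]= x S (Equivalence.to T-≡ p)

T-≢∧∈ : ∀ {k l} {x y : Fin k} {S : Subset l} {z} → x ≢ y → z ∈ S →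
        T (not ⌊ x ≟ y ⌋ ∧ lookup S z)
T-≢∧∈ x≢y z∈S = Equivalence.from T-∧ (fromWitnessFalse x≢y , ∈⇒T-lookup z∈S)

∈-∪⁅⁆ : ∀ {k} {S : Subset k} {x y} → x ∈ S ∪ ⁅ y ⁆ → x ∈ S ⊎ x ≡ y
∈-∪⁅⁆ {S = S} {y = y} = Sum.map₂ (x∈⁅y⁆⇒x≡y y) ∘ x∈p∪q⁻ S ⁅ y ⁆

𝟙-∨ : ∀ {a b} → (T a → T b → ⊥) → 𝟙 (a ∨ b) ≡ 𝟙 a + 𝟙 b
𝟙-∨ {true}  {true}  disjoint = ⊥-elim (disjoint tt tt)
𝟙-∨ {true}  {false} _        = refl
𝟙-∨ {false}         _        = refl

𝟙-adjacent : ∀ a b s → 𝟙 (s ∧ ((a ∧ not b) ∨ (b ∧ not a))) ≡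
             𝟙 a * 𝟙 (not b ∧ s) + 𝟙 b * 𝟙 (not a ∧ s)
𝟙-adjacent true  true  true  = refl
𝟙-adjacent true  true  false = refl
𝟙-adjacent true  false true  = refl
𝟙-adjacent true  false false = refl
𝟙-adjacent false true  true  = refl
𝟙-adjacent false true  false = refl
𝟙-adjacent false false true  = refl
𝟙-adjacent false false false = refl

module _ {m n : ℕ} where

  rowNbrs colNbrs : Subset (m * n) → Fin m → Fin n → ℕ
  rowNbrs S i c = ∑[ v < n ] 𝟙 (not ⌊ c ≟ v ⌋ ∧ lookup S (combine i v))
  colNbrs S i c = ∑[ u < m ] 𝟙 (not ⌊ i ≟ u ⌋ ∧ lookup S (combine u c))

  adj-combine : ∀ i u c v → adj (K m □ K n) (combine i c) (combine u v) ≡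
                (⌊ i ≟ u ⌋ ∧ not ⌊ c ≟ v ⌋) ∨ (⌊ c ≟ v ⌋ ∧ not ⌊ i ≟ u ⌋)
  adj-combine i u c v = cong₂ adjacent (remQuot-combine i c) (remQuot-combine u v)
    where
    adjacent : Fin m × Fin n → Fin m × Fin n → Bool
    adjacent (i , c) (u , v) = (⌊ i ≟ u ⌋ ∧ not ⌊ c ≟ v ⌋) ∨ (⌊ c ≟ v ⌋ ∧ not ⌊ i ≟ u ⌋)

  ∣∩N∣≡rowNbrs+colNbrs : ∀ S i c →
    ∣ S ∩ N[ K m □ K n ] (combine i c) ∣ ≡ rowNbrs S i c + colNbrs S i c
  ∣∩N∣≡rowNbrs+colNbrs S i c = begin
    ∣ S ∩ N[ G ] x ∣
      ≡⟨ ∣∣≡∑𝟙 (S ∩ N[ G ] x) ⟩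
    ∑[ y < m * n ] 𝟙 (lookup (S ∩ N[ G ] x) y)
      ≡⟨ ∑-combine m n _ ⟩
    ∑[ u < m ] ∑[ v < n ] 𝟙 (lookup (S ∩ N[ G ] x) (combine u v))
      ≡⟨ sum-cong-≗ (λ u → sum-cong-≗ (split u)) ⟩
    ∑[ u < m ] ∑[ v < n ] (in-row u v + in-col u v)
      ≡⟨ sum-cong-≗ (λ u → ∑-distrib-+ (in-row u) (in-col u)) ⟩
    ∑[ u < m ] (∑[ v < n ] in-row u v + ∑[ v < n ] in-col u v)
      ≡⟨ ∑-distrib-+ (λ u → ∑[ v < n ] in-row u v) (λ u → ∑[ v < n ] in-col u v) ⟩
    ∑[ u < m ] ∑[ v < n ] in-row u v + ∑[ u < m ] ∑[ v < n ] in-col u v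
      ≡⟨ cong₂ _+_ row col ⟩
    rowNbrs S i c + colNbrs S i c ∎
    where
    open ≡-Reasoning
    G = K m □ K n
    x = combine i c
    s : Fin m → Fin n → Bool
    s u v = lookup S (combine u v)
    a : Fin m → Bool
    a u = ⌊ i ≟ u ⌋
    b : Fin n → Bool
    b v = ⌊ c ≟ v ⌋
    in-row in-col : Fin m → Fin n → ℕ
    in-row u v = 𝟙 (a u) * 𝟙 (not (b v) ∧ s u v)
    in-col u v = 𝟙 (b v) * 𝟙 (not (a u) ∧ s u v)
    split : ∀ u v → 𝟙 (lookup (S ∩ N[ G ] x) (combine u v)) ≡ in-row u v + in-col u v
    split u v = begin
      𝟙 (lookup (S ∩ N[ G ] x) y)     ≡⟨ cong 𝟙 (lookup-zipWith _∧_ y S (N[ G ] x)) ⟩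
      𝟙 (s u v ∧ lookup (N[ G ] x) y) ≡⟨ cong (λ e → 𝟙 (s u v ∧ e)) (lookup∘tabulate (adj G x) y) ⟩
      𝟙 (s u v ∧ adj G x y)           ≡⟨ cong (λ e → 𝟙 (s u v ∧ e)) (adj-combine i u c v) ⟩
      _                               ≡⟨ 𝟙-adjacent (a u) (b v) (s u v) ⟩
      in-row u v + in-col u v         ∎
      where y = combine u v
    row : ∑[ u < m ] ∑[ v < n ] in-row u v ≡ rowNbrs S i c
    row = trans (sum-cong-≗ (λ u → sym (*-distribˡ-sum (𝟙 (a u)) (λ v → 𝟙 (not (b v) ∧ s u v)))))
                (∑-δ m i (λ u → ∑[ v < n ] 𝟙 (not (b v) ∧ s u v)))
    col : ∑[ u < m ] ∑[ v < n ] in-col u v ≡ colNbrs S i c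
    col = sum-cong-≗ (λ u → ∑-δ n c (λ v → 𝟙 (not (a u) ∧ s u v)))

  rowSize : Subset (m * n) → Fin m → ℕ
  rowSize S i = ∑[ v < n ] 𝟙 (lookup S (combine i v))

  ∣∣≡∑rowSize : ∀ S → ∣ S ∣ ≡ ∑[ i < m ] rowSize S i
  ∣∣≡∑rowSize S = trans (∣∣≡∑𝟙 S) (∑-combine m n _)

  rowSize-full : ∀ {S} i → (∀ v → combine i v ∈ S) → rowSize S i ≡ n
  rowSize-full i full = trans (sum-cong-≗ {n} (λ v → cong 𝟙 ([]=⇒lookup (full v))))
                              (trans (∑-const n 1) (*-identityʳ n))

  rowSize-mono : ∀ {S S′} i → (∀ v → combine i v ∈ S → combine i v ∈ S′) →
                 rowSize S i ≤ rowSize S′ i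
  rowSize-mono i S⊆S′ = ∑𝟙-mono {n} (λ v → ∈⇒T-lookup ∘ S⊆S′ v ∘ T-lookup⇒∈)

  rowNbrs≤rowSize : ∀ S i c → rowNbrs S i c ≤ rowSize S i
  rowNbrs≤rowSize S i c = ∑𝟙-mono {n} (λ v → proj₂ ∘ Equivalence.to T-∧)

  colNbrs≤m∸1 : ∀ S i c → colNbrs S i c ≤ m ∸ 1
  colNbrs≤m∸1 S i c =
    ≤-trans (∑𝟙-mono {m} (λ u → proj₁ ∘ Equivalence.to T-∧)) (≤-reflexive (∑𝟙-≢ i))

module _ {m n t k : ℕ} (k+m∸1≤t : k + (m ∸ 1) ≤ t) (k≤n : k ≤ n) {D : Subset (m * n)} where

  RowWithinD : Subset (m * n) → Fin m → Set
  RowWithinD S i = ∀ v → combine i v ∈ S → combine i v ∈ D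

  large-if-activated-outside-D : ∀ {S} i c → RowWithinD S i →
    t ≤ ∣ S ∩ N[ K m □ K n ] (combine i c) ∣ → k ≤ rowSize D i
  large-if-activated-outside-D {S} i c within t≤ = +-cancelʳ-≤ (m ∸ 1) k (rowSize D i) (begin
    k + (m ∸ 1)                         ≤⟨ k+m∸1≤t ⟩
    t                                   ≤⟨ t≤ ⟩
    ∣ S ∩ N[ K m □ K n ] (combine i c) ∣ ≡⟨ ∣∩N∣≡rowNbrs+colNbrs S i c ⟩
    rowNbrs S i c + colNbrs S i c       ≤⟨ +-mono-≤ (rowNbrs≤rowSize S i c) (colNbrs≤m∸1 S i c) ⟩
    rowSize S i + (m ∸ 1)               ≤⟨ +-monoˡ-≤ (m ∸ 1) (rowSize-mono i within) ⟩
    rowSize D i + (m ∸ 1)               ∎)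
    where open ≤-Reasoning

  rows-within-D-or-large : ∀ {S} → Reach (K m □ K n) t D S → ∀ i → RowWithinD S i ⊎ k ≤ rowSize D i
  rows-within-D-or-large start i = inj₁ (λ v → id)
  rows-within-D-or-large (add y r t≤) i with rows-within-D-or-large r i
  ... | inj₂ large = inj₂ large
  ... | inj₁ within with y ∈? D | combine-surjective {m} {n} y
  ...   | yes y∈D | _ = inj₁ (λ v → [ within v , (λ { refl → y∈D }) ]′ ∘ ∈-∪⁅⁆)
  ...   | no  _   | j , c , refl with j ≟ i
  ...     | yes refl = inj₂ (large-if-activated-outside-D i c within t≤)
  ...     | no  j≢i  =
    inj₁ (λ v → [ within v , ⊥-elim ∘ j≢i ∘ sym ∘ combine-injectiveˡ i v j c ]′ ∘ ∈-∪⁅⁆)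

  dyn-lower : DynMono (K m □ K n) t D → m * k ≤ ∣ D ∣
  dyn-lower r = begin
    m * k                   ≡⟨ ∑-const m k ⟨
    ∑[ i < m ] k            ≤⟨ ∑-mono-≤ row-large ⟩
    ∑[ i < m ] rowSize D i  ≡⟨ ∣∣≡∑rowSize {m} {n} D ⟨
    ∣ D ∣                   ∎
    where
    open ≤-Reasoning
    row-large : ∀ i → k ≤ rowSize D i
    row-large i with rows-within-D-or-large r i
    ... | inj₂ large  = large
    ... | inj₁ within = ≤-trans k≤n (≤-reflexive (sym (rowSize-full i (λ v → within v ∈⊤))))

module Spreading (G : Graph) (t : ℕ) (D : Subset (order G)) where

  Spreads : (Fin (order G) → Set) → Set
  Spreads P = ∃ λ S → Reach G t D S × (∀ {x} → P x → x ∈ S)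

  spreads-D : Spreads (_∈ D)
  spreads-D = D , start , id

  spreads-⊆ : ∀ {P Q} → (∀ {x} → Q x → P x) → Spreads P → Spreads Q
  spreads-⊆ Q⊆P (S , r , P⊆S) = S , r , P⊆S ∘ Q⊆P

  spreads-add : ∀ {P} x → (∀ {S} → (∀ {y} → P y → y ∈ S) → t ≤ ∣ S ∩ N[ G ] x ∣) →
                Spreads P → Spreads (λ y → P y ⊎ y ≡ x)
  spreads-add x enough (S , r , P⊆S) =
    S ∪ ⁅ x ⁆ , add x r (enough P⊆S) , x∈p∪q⁺ ∘ Sum.map P⊆S (λ { refl → x∈⁅x⁆ x })

  spreads-all : ∀ {P} → (∀ x → P x) → Spreads P → DynMono G t D
  spreads-all everywhere (S , r , P⊆S) =
    subst (Reach G t D) (⊆-antisym ⊆⊤ (λ {x} _ → P⊆S (everywhere x))) r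

outside : ℕ → ℕ → ℕ → Bool
outside a b x = (x <ᵇ a) ∨ (b ≤ᵇ x)

T-outside⁺ : ∀ {a b x} → x < a ⊎ b ≤ x → T (outside a b x)
T-outside⁺ = Equivalence.from T-∨ ∘ Sum.map <⇒<ᵇ ≤⇒≤ᵇ

T-outside⁻ : ∀ {a b x} → T (outside a b x) → x < a ⊎ b ≤ x
T-outside⁻ {a} {b} {x} = Sum.map (<ᵇ⇒< x a) (≤ᵇ⇒≤ b x) ∘ Equivalence.to T-∨

∑𝟙-<ᵇ : ∀ n a → a ≤ n → ∑[ v < n ] 𝟙 (toℕ v <ᵇ a) ≡ a
∑𝟙-<ᵇ zero    zero    _         = refl
∑𝟙-<ᵇ (suc n) zero    _         = trans (∑-const n 0) (*-zeroʳ n)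
∑𝟙-<ᵇ (suc n) (suc a) (s≤s a≤n) = cong suc (∑𝟙-<ᵇ n a a≤n)

∑𝟙-≤ᵇ : ∀ n b → ∑[ v < n ] 𝟙 (b ≤ᵇ toℕ v) ≡ n ∸ b
∑𝟙-≤ᵇ zero    b       = sym (0∸n≡0 b)
∑𝟙-≤ᵇ (suc n) zero    = cong suc (∑𝟙-≤ᵇ n 0)
∑𝟙-≤ᵇ (suc n) (suc b) = trans (sum-cong-≗ {n} (λ v → cong 𝟙 (≤ᵇ-suc b (toℕ v)))) (∑𝟙-≤ᵇ n b)
  where
  ≤ᵇ-suc : ∀ b x → (suc b ≤ᵇ suc x) ≡ (b ≤ᵇ x)
  ≤ᵇ-suc zero    x = refl
  ≤ᵇ-suc (suc b) x = refl

∑𝟙-outside : ∀ n {a b} → a ≤ b → a ≤ n → ∑[ v < n ] 𝟙 (outside a b (toℕ v)) ≡ a + (n ∸ b)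
∑𝟙-outside n {a} {b} a≤b a≤n = begin
  ∑[ v < n ] 𝟙 (outside a b (toℕ v))
    ≡⟨ sum-cong-≗ {n} (λ v → 𝟙-∨ (disjoint (toℕ v))) ⟩
  ∑[ v < n ] (𝟙 (toℕ v <ᵇ a) + 𝟙 (b ≤ᵇ toℕ v))
    ≡⟨ ∑-distrib-+ {n} (λ v → 𝟙 (toℕ v <ᵇ a)) (λ v → 𝟙 (b ≤ᵇ toℕ v)) ⟩
  ∑[ v < n ] 𝟙 (toℕ v <ᵇ a) + ∑[ v < n ] 𝟙 (b ≤ᵇ toℕ v)
    ≡⟨ cong₂ _+_ (∑𝟙-<ᵇ n a a≤n) (∑𝟙-≤ᵇ n b) ⟩
  a + (n ∸ b) ∎
  where
  open ≡-Reasoning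
  disjoint : ∀ x → T (x <ᵇ a) → T (b ≤ᵇ x) → ⊥
  disjoint x x<a b≤x = <⇒≱ (<-≤-trans (<ᵇ⇒< x a x<a) a≤b) (≤ᵇ⇒≤ b x b≤x)

[a+x]+[b+y]≡[b+x]+[a+y] : ∀ a b x y → (a + x) + (b + y) ≡ (b + x) + (a + y)
[a+x]+[b+y]≡[b+x]+[a+y] = solve 4 (λ a b x y → (a :+ x) :+ (b :+ y) := (b :+ x) :+ (a :+ y)) refl
  where open +-*-Solver

module _ {m n t k : ℕ} (m≤k : m ≤ k) (k≤n : k ≤ n) (t≤k+m∸1 : t ≤ k + (m ∸ 1)) where

  private
    L = n ∸ k
    G = K m □ K n

  i+[n∸[L+i]]≡k : ∀ {i} → i ≤ k → i + (n ∸ (L + i)) ≡ k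
  i+[n∸[L+i]]≡k {i} i≤k = begin
    i + (n ∸ (L + i)) ≡⟨ cong (i +_) (∸-+-assoc n L i) ⟨
    i + (n ∸ L ∸ i)   ≡⟨ cong (λ z → i + (z ∸ i)) (m∸[m∸n]≡n k≤n) ⟩
    i + (k ∸ i)       ≡⟨ m+[n∸m]≡n i≤k ⟩
    k                 ∎
    where open ≡-Reasoning

  inD : Fin m → Fin n → Bool
  inD u v = outside (toℕ u) (L + toℕ u) (toℕ v)

  T-inD⁺ : ∀ {u v} → toℕ v < toℕ u ⊎ L + toℕ u ≤ toℕ v → T (inD u v)
  T-inD⁺ = T-outside⁺

  D : Subset (m * n)
  D = tabulate (uncurry inD ∘ remQuot n)

  lookup-D : ∀ u v → lookup D (combine u v) ≡ inD u v
  lookup-D u v = trans (lookup∘tabulate _ (combine u v)) (cong (uncurry inD) (remQuot-combine u v))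

  ∣D∣≡m*k : ∣ D ∣ ≡ m * k
  ∣D∣≡m*k = trans (∣∣≡∑rowSize {m} {n} D) (trans (sum-cong-≗ {m} row-k) (∑-const m k))
    where
    row-k : ∀ u → rowSize D u ≡ k
    row-k u = begin
      rowSize D u                           ≡⟨ sum-cong-≗ {n} (cong 𝟙 ∘ lookup-D u) ⟩
      ∑[ v < n ] 𝟙 (inD u v)                ≡⟨ ∑𝟙-outside n (m≤n+m (toℕ u) L) (≤-trans u≤k k≤n) ⟩
      toℕ u + (n ∸ (L + toℕ u))             ≡⟨ i+[n∸[L+i]]≡k u≤k ⟩
      k                                     ∎
      where
      open ≡-Reasoning
      u≤k = ≤-trans (<⇒≤ (toℕ<n u)) m≤k

  Done : ℕ → ℕ → Fin m → Fin n → Set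
  Done i a u v = toℕ u < i ⊎ T (inD u v) ⊎ (toℕ u ≡ i × toℕ v < a)

  Cells : (Fin m → Fin n → Set) → Fin (m * n) → Set
  Cells q x = ∃₂ λ u v → combine u v ≡ x × q u v

  open Spreading G t D

  spreads-start : Spreads (Cells (Done 0 0))
  spreads-start = spreads-⊆ in-D spreads-D
    where
    in-D : ∀ {x} → Cells (Done 0 0) x → x ∈ D
    in-D (u , v , refl , inj₂ (inj₁ d)) = T-lookup⇒∈ (subst T (sym (lookup-D u v)) d)

  threshold≤ : ∀ {i} a → i ≤ k → t ≤ (a + (n ∸ (L + i))) + (i + (m ∸ suc a))
  threshold≤ {i} a i≤k = begin
    t                                         ≤⟨ t≤k+m∸1 ⟩
    k + (m ∸ 1)                               ≤⟨ +-monoʳ-≤ k m∸1≤a+[m∸[1+a]] ⟩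
    k + (a + (m ∸ suc a))                     ≡⟨ cong (_+ (a + (m ∸ suc a))) (i+[n∸[L+i]]≡k i≤k) ⟨
    (i + (n ∸ (L + i))) + (a + (m ∸ suc a))   ≡⟨ [a+x]+[b+y]≡[b+x]+[a+y] i a _ _ ⟩
    (a + (n ∸ (L + i))) + (i + (m ∸ suc a))   ∎
    where
    open ≤-Reasoning
    m∸1≤a+[m∸[1+a]] : m ∸ 1 ≤ a + (m ∸ suc a)
    m∸1≤a+[m∸[1+a]] = ≤-trans (m≤n+m∸n (m ∸ 1) a) (≤-reflexive (cong (a +_) (∸-+-assoc m 1 a)))

  column<n : ∀ (r : Fin m) {a} → a < L + toℕ r → a < n
  column<n r a<L+i = <-≤-trans a<L+i (begin
    L + toℕ r ≤⟨ +-monoʳ-≤ L (≤-trans (<⇒≤ (toℕ<n r)) m≤k) ⟩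
    L + k     ≡⟨ m∸n+n≡m k≤n ⟩
    n         ∎)
    where open ≤-Reasoning

  threshold-reached : ∀ (r : Fin m) (c : Fin n) → toℕ r ≤ toℕ c → toℕ c < L + toℕ r →
    ∀ {S} → (∀ {y} → Cells (Done (toℕ r) (toℕ c)) y → y ∈ S) → t ≤ ∣ S ∩ N[ G ] (combine r c) ∣
  threshold-reached r c i≤a a<L+i {S} done⊆S = begin
    t
      ≤⟨ threshold≤ a (≤-trans (<⇒≤ (toℕ<n r)) m≤k) ⟩
    (a + (n ∸ (L + i))) + (i + (m ∸ suc a))
      ≡⟨ cong₂ _+_ (∑𝟙-outside n (<⇒≤ a<L+i) (<⇒≤ (toℕ<n c)))
                   (∑𝟙-outside m (m≤n⇒m≤1+n i≤a) (<⇒≤ (toℕ<n r))) ⟨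
    ∑[ v < n ] 𝟙 (outside a (L + i) (toℕ v)) + ∑[ u < m ] 𝟙 (outside i (suc a) (toℕ u))
      ≤⟨ +-mono-≤ (∑𝟙-mono {n} row-done) (∑𝟙-mono {m} col-done) ⟩
    rowNbrs S r c + colNbrs S r c
      ≡⟨ ∣∩N∣≡rowNbrs+colNbrs S r c ⟨
    ∣ S ∩ N[ G ] (combine r c) ∣ ∎
    where
    open ≤-Reasoning
    i = toℕ r
    a = toℕ c
    row-done : ∀ v → T (outside a (L + i) (toℕ v)) → T (not ⌊ c ≟ v ⌋ ∧ lookup S (combine r v))
    row-done v h with T-outside⁻ h
    ... | inj₁ v<a   = T-≢∧∈ (λ { refl → <-irrefl refl v<a })
                             (done⊆S (r , v , refl , inj₂ (inj₂ (refl , v<a))))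
    ... | inj₂ L+i≤v = T-≢∧∈ (λ { refl → <⇒≱ a<L+i L+i≤v })
                             (done⊆S (r , v , refl , inj₂ (inj₁ (T-inD⁺ (inj₂ L+i≤v)))))
    col-done : ∀ u → T (outside i (suc a) (toℕ u)) → T (not ⌊ r ≟ u ⌋ ∧ lookup S (combine u c))
    col-done u h with T-outside⁻ h
    ... | inj₁ u<i = T-≢∧∈ (λ { refl → <-irrefl refl u<i })
                           (done⊆S (u , c , refl , inj₁ u<i))
    ... | inj₂ a<u = T-≢∧∈ (λ { refl → <⇒≱ a<u i≤a })
                           (done⊆S (u , c , refl , inj₂ (inj₁ (T-inD⁺ (inj₁ a<u)))))

  Done-suc : ∀ (r : Fin m) (c : Fin n) {x} → Cells (Done (toℕ r) (suc (toℕ c))) x →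
             Cells (Done (toℕ r) (toℕ c)) x ⊎ x ≡ combine r c
  Done-suc r c (u , v , refl , inj₁ u<i)       = inj₁ (u , v , refl , inj₁ u<i)
  Done-suc r c (u , v , refl , inj₂ (inj₁ d)) = inj₁ (u , v , refl , inj₂ (inj₁ d))
  Done-suc r c (u , v , refl , inj₂ (inj₂ (u≡i , v<1+a))) with m<1+n⇒m<n∨m≡n v<1+a
  ... | inj₁ v<a = inj₁ (u , v , refl , inj₂ (inj₂ (u≡i , v<a)))
  ... | inj₂ v≡a = inj₂ (cong₂ combine (toℕ-injective u≡i) (toℕ-injective v≡a))

  column-step : ∀ (r : Fin m) a → toℕ r ≤ a → a < L + toℕ r →
                Spreads (Cells (Done (toℕ r) a)) → Spreads (Cells (Done (toℕ r) (suc a)))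
  column-step r a i≤a a<L+i with fromℕ< (column<n r a<L+i) | toℕ-fromℕ< (column<n r a<L+i)
  ... | c | refl =
    spreads-⊆ (Done-suc r c) ∘ spreads-add (combine r c) (threshold-reached r c i≤a a<L+i)

  row-step : ∀ (r : Fin m) → Spreads (Cells (Done (toℕ r) (toℕ r))) →
             Spreads (Cells (Done (suc (toℕ r)) (suc (toℕ r))))
  row-step r = spreads-⊆ next-row ∘ sweep L ≤-refl
    where
    i = toℕ r
    sweep : ∀ j → j ≤ L → Spreads (Cells (Done i i)) → Spreads (Cells (Done i (j + i)))
    sweep zero    _   = id
    sweep (suc j) j<L = column-step r (j + i) (m≤n+m i j) (+-monoˡ-< i j<L) ∘ sweep j (<⇒≤ j<L)
    next-row : ∀ {x} → Cells (Done (suc i) (suc i)) x → Cells (Done i (L + i)) x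
    next-row (u , v , refl , inj₂ (inj₁ d)) = u , v , refl , inj₂ (inj₁ d)
    next-row (u , v , refl , inj₂ (inj₂ (u≡1+i , v<1+i))) =
      u , v , refl , inj₂ (inj₁ (T-inD⁺ (inj₁ (subst (toℕ v <_) (sym u≡1+i) v<1+i))))
    next-row (u , v , refl , inj₁ u<1+i) with m<1+n⇒m<n∨m≡n u<1+i
    ... | inj₁ u<i = u , v , refl , inj₁ u<i
    ... | inj₂ u≡i with toℕ v <? L + i
    ...   | yes v<L+i = u , v , refl , inj₂ (inj₂ (u≡i , v<L+i))
    ...   | no  v≮L+i =
      u , v , refl , inj₂ (inj₁ (T-inD⁺ (inj₂ (subst (λ z → L + z ≤ toℕ v) (sym u≡i) (≮⇒≥ v≮L+i)))))

  spreads-rows : ∀ i → i ≤ m → Spreads (Cells (Done i i))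
  spreads-rows zero    _   = spreads-start
  spreads-rows (suc i) i<m = row-step-at i<m (spreads-rows i (<⇒≤ i<m))
    where
    row-step-at : ∀ {i} → i < m →
                  Spreads (Cells (Done i i)) → Spreads (Cells (Done (suc i) (suc i)))
    row-step-at i<m with fromℕ< i<m | toℕ-fromℕ< i<m
    ... | r | refl = row-step r

  dyn-upper : ∃ λ D → DynMono G t D × ∣ D ∣ ≡ m * k
  dyn-upper = D , spreads-all every-cell (spreads-rows m ≤-refl) , ∣D∣≡m*k
    where
    every-cell : ∀ x → Cells (Done m m) x
    every-cell x with combine-surjective {m} {n} x
    ... | u , v , eq = u , v , eq , inj₁ (toℕ<n u)

theorem16 : (m n t : ℕ) → 0 < m → 0 < n → 0 < t →
    2 * m < t → t ∸ m + 1 < n →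
    DynEq (K m □ K n) t (m * (t ∸ m + 1))
theorem16 m n t 0<m _ _ 2m<t k<n =
  dyn-upper m≤k k≤n (≤-reflexive (sym k+[m∸1]≡t)) ,
  λ _ → dyn-lower {m} {n} (≤-reflexive k+[m∸1]≡t) k≤n
  where
  k = t ∸ m + 1
  k≤n = <⇒≤ k<n
  m+m<t : m + m < t
  m+m<t = subst (_< t) (cong (m +_) (+-identityʳ m)) 2m<t
  m≤k : m ≤ k
  m≤k = ≤-trans (m+n≤o⇒m≤o∸n m (<⇒≤ m+m<t)) (m≤m+n (t ∸ m) 1)
  k+[m∸1]≡t : k + (m ∸ 1) ≡ t
  k+[m∸1]≡t = begin
    t ∸ m + 1 + (m ∸ 1)   ≡⟨ +-assoc (t ∸ m) 1 (m ∸ 1) ⟩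
    t ∸ m + (1 + (m ∸ 1)) ≡⟨ cong (t ∸ m +_) (m+[n∸m]≡n 0<m) ⟩
    t ∸ m + m             ≡⟨ m∸n+n≡m (≤-trans (m≤m+n m m) (<⇒≤ m+m<t)) ⟩
    t                     ∎
    where open ≡-Reasoning
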